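{- Let $G$ be a simple graph of order $n\ge2$ and $t$ a positive integer. If $G$ is triangle-free, then $S[G,t]$ is triangle-free.
   Context: Let $G$ be a simple graph with vertex set $V=\{1,\dots,n\}$, $n\ge 2$. For $t\ge 1$, the generalized Sierpiński graph $S(G,t)$ has vertex set $V^t$ (words $u_1u_2\cdots u_t$ over $V$), and two words ${\bf u}=u_1\cdots u_t$, ${\bf v}=v_1\cdots v_t$ are adjacent iff there is $i\in\{1,\dots,t\}$ with $u_j=v_j$ for $j<i$, $u_i\neq v_i$ and $u_iv_i\in E(G)$, and $u_j=v_i$, $v_j=u_i$ for all $j>i$. An edge of this kind with $i<t$ is called a linking edge. The generalized Sierpiński gasket $S[G,t]$ is the graph obtained from $S(G,t)$ by contracting all linking edges (so $S[G,1]=G$). -}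

module Defs where

open import Level using (0ℓ)
open import Data.Nat using (ℕ; suc; _<_)
open import Data.Fin using (Fin; toℕ)
open import Data.Product using (Σ; ∃; _×_; _,_)
open import Relation.Nullary using (¬_)
open import Relation.Binary.PropositionalEquality using (_≡_)
open import Relation.Binary.Construct.Closure.Equivalence using (EqClosure)

record SimpleGraph (n : ℕ) : Set₁ where
  field
    Adj     : Fin n → Fin n → Set
    sym     : ∀ {x y} → Adj x y → Adj y x
    irrefl  : ∀ {x} → ¬ Adj x x
open SimpleGraph public

TriangleFreeRel : {A : Set} → (A → A → Set) → Set
TriangleFreeRel {A} R =
  ¬ (Σ A λ a → Σ A λ b → Σ A λ c →
       (¬ a ≡ b) × (¬ b ≡ c) × (¬ a ≡ c) × R a b × R b c × R a c)

TriangleFree : ∀ {n} → SimpleGraph n → Set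
TriangleFree G = TriangleFreeRel (Adj G)

-- Words of length t over Fin n (vertices of S(G,t)).
Word : ℕ → ℕ → Set
Word n t = Fin t → Fin n

SAdjAt : ∀ {n t} → SimpleGraph n → Fin t → Word n t → Word n t → Set
SAdjAt G i u v =
  (∀ j → toℕ j < toℕ i → u j ≡ v j) ×
  (¬ u i ≡ v i) ×
  Adj G (u i) (v i) ×
  (∀ j → toℕ i < toℕ j → (u j ≡ v i) × (v j ≡ u i))

SAdj : ∀ {n t} → SimpleGraph n → Word n t → Word n t → Set
SAdj {t = t} G u v = ∃ λ (i : Fin t) → SAdjAt G i u v

-- Linking edges: edges of S(G,t) at a position i < t (1-based), i.e. toℕ i + 1 < t.
LinkingEdge : ∀ {n t} → SimpleGraph n → Word n t → Word n t → Set
LinkingEdge {t = t} G u v = ∃ λ (i : Fin t) → (suc (toℕ i) < t) × SAdjAt G i u v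

-- Two words are identified in S[G,t] iff they are connected by linking edges
-- (equivalence closure of the linking-edge relation).
Identified : ∀ {n t} → SimpleGraph n → Word n t → Word n t → Set
Identified G = EqClosure (LinkingEdge G)

-- Adjacency in the generalized Sierpiński gasket S[G,t] (contraction of all
-- linking edges of S(G,t)), expressed on representatives: the classes of u and v
-- are distinct and some edge of S(G,t) joins a member of one to a member of the other.
GAdj : ∀ {n t} → SimpleGraph n → Word n t → Word n t → Set
GAdj G u v =
  (¬ Identified G u v) ×
  (Σ _ λ u' → Σ _ λ v' → Identified G u u' × Identified G v v' × SAdj G u' v')

GasketTriangleFree : ∀ {n} → SimpleGraph n → ℕ → Set
GasketTriangleFree {n} G t =
  ¬ (Σ (Word n t) λ a → Σ (Word n t) λ b → Σ (Word n t) λ c →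
       GAdj G a b × GAdj G b c × GAdj G a c)

{-# OPTIONS --safe #-}
-- A word u has at most one linking neighbour, since the position of a linking
-- edge at u must be the last position where u differs from its final letter.
-- So a vertex of S[G,t] is a single word or a linked pair, and a triangle of
-- S[G,t] lifts to a hexagon a₁ b₁ ~ b₂ c₂ ~ c₃ a₃ ~ a₁ in which the steps
-- a₁b₁, b₂c₂, c₃a₃ are edges of S(G,t) inside a copy of G (they change only the
-- last letter) and each ~ is an equality or a linking edge.  If no ~ is a
-- linking edge, the last letters form a triangle of G.  Otherwise read the
-- letters at the least level m of a linking edge around the hexagon: one
-- linking edge at level m would change the letter at m while every other step
-- preserves it, three would form a triangle of G, and with two the copy edge
-- between them would join words with the same last letter.
module Submission where

open import Defs hiding (sym)
open import Data.Nat using (ℕ; _≤_; zero; suc; _⊓_; _<?_; s≤s; s≤s⁻¹)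
open import Data.Nat.Properties using (≮⇒≥; <⇒≱; ≤-trans; ≤∧≢⇒<; <-irrefl; m⊓n≤m; m⊓n≤n; ⊓-glb)
import Data.Nat as ℕ
open import Data.Fin using (Fin; toℕ; fromℕ; fromℕ<; _<_; _≟_)
open import Data.Fin.Properties using (toℕ<n; toℕ-fromℕ; toℕ-fromℕ<; fromℕ<-toℕ; ≤fromℕ; <-cmp)
import Data.Fin.Properties as Fin
open import Data.Product using (Σ; _×_; _,_; proj₁; proj₂; swap)
open import Data.Sum using (_⊎_; inj₁; inj₂)
open import Data.Empty using (⊥; ⊥-elim)
open import Relation.Nullary using (¬_; yes; no)
open import Relation.Binary.Definitions using (tri<; tri≈; tri>)
open import Relation.Binary.Structures using (IsEquivalence)
open import Relation.Binary.PropositionalEquality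
  using (_≡_; _≢_; _≗_; refl; sym; trans; subst; subst₂; module ≡-Reasoning)
import Relation.Binary.Construct.Closure.Equivalence as EC

module _ {n : ℕ} (G : SimpleGraph n) where

  Adj⇒≢ : ∀ {x y} → Adj G x y → x ≢ y
  Adj⇒≢ xy refl = irrefl G xy

  TriangleFree⇒¬3-cycle : TriangleFree G → ∀ {x y z} →
                          Adj G x y → Adj G y z → Adj G z x → ⊥
  TriangleFree⇒¬3-cycle tf {x} {y} {z} xy yz zx =
    tf (x , y , z , Adj⇒≢ xy , Adj⇒≢ yz , Adj⇒≢ xz , xy , yz , xz)
    where xz = SimpleGraph.sym G zx

  module _ {t : ℕ} {i : Fin t} {u v : Word n t} where

    SAdjAt-prefix : SAdjAt G i u v → ∀ {j} → j < i → u j ≡ v j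
    SAdjAt-prefix (prefix , _) j<i = prefix _ j<i

    SAdjAt-≢ : SAdjAt G i u v → u i ≢ v i
    SAdjAt-≢ (_ , ui≢vi , _) = ui≢vi

    SAdjAt-adj : SAdjAt G i u v → Adj G (u i) (v i)
    SAdjAt-adj (_ , _ , adj , _) = adj

    SAdjAt-suffixˡ : SAdjAt G i u v → ∀ {j} → i < j → u j ≡ v i
    SAdjAt-suffixˡ (_ , _ , _ , suffix) i<j = proj₁ (suffix _ i<j)

    SAdjAt-suffixʳ : SAdjAt G i u v → ∀ {j} → i < j → v j ≡ u i
    SAdjAt-suffixʳ (_ , _ , _ , suffix) i<j = proj₂ (suffix _ i<j)

    SAdjAt-sym : SAdjAt G i u v → SAdjAt G i v u
    SAdjAt-sym (prefix , ui≢vi , adj , suffix) =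
      (λ j j<i → sym (prefix j j<i)) , (λ vi≡ui → ui≢vi (sym vi≡ui)) ,
      SimpleGraph.sym G adj , (λ j i<j → swap (suffix j i<j))

  SAdjAt-respˡ : ∀ {t} {i : Fin t} {u u′ v} → u ≗ u′ → SAdjAt G i u v → SAdjAt G i u′ v
  SAdjAt-respˡ {i = i} {v = v} u≗u′ (prefix , ui≢vi , adj , suffix) =
    (λ j j<i → trans (sym (u≗u′ j)) (prefix j j<i)) ,
    (λ u′i≡vi → ui≢vi (trans (u≗u′ i) u′i≡vi)) ,
    subst (λ x → Adj G x (v i)) (u≗u′ i) adj ,
    (λ j i<j → trans (sym (u≗u′ j)) (proj₁ (suffix j i<j)) ,
               trans (proj₂ (suffix j i<j)) (u≗u′ i))

  SAdjAt-respʳ : ∀ {t} {i : Fin t} {u v v′} → v ≗ v′ → SAdjAt G i u v → SAdjAt G i u v′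
  SAdjAt-respʳ v≗v′ uv = SAdjAt-sym (SAdjAt-respˡ v≗v′ (SAdjAt-sym uv))

module Gasket {n : ℕ} (G : SimpleGraph n) (t′ : ℕ) where

  W : Set
  W = Word n (suc t′)

  last : Fin (suc t′)
  last = fromℕ t′

  linking⇒<last : ∀ {i : Fin (suc t′)} → suc (toℕ i) ℕ.< suc t′ → i < last
  linking⇒<last {i} p = subst (toℕ i ℕ.<_) (sym (toℕ-fromℕ t′)) (s≤s⁻¹ p)

  <last⇒linking : ∀ {i : Fin (suc t′)} → i < last → suc (toℕ i) ℕ.< suc t′
  <last⇒linking {i} i<last = s≤s (subst (toℕ i ℕ.<_) (toℕ-fromℕ t′) i<last)

  CopyEdge : W → W → Set
  CopyEdge = SAdjAt G last

  LinkedAt : Fin (suc t′) → W → W → Set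
  LinkedAt i u v = i < last × SAdjAt G i u v

  LastDeviation : W → Fin (suc t′) → Set
  LastDeviation u i = u i ≢ u last × (∀ j → i < j → u j ≡ u last)

  LastDeviation-unique : ∀ {u i i′} → LastDeviation u i → LastDeviation u i′ → i ≡ i′
  LastDeviation-unique {i = i} {i′} (ui≢ , after-i) (ui′≢ , after-i′) with <-cmp i i′
  ... | tri< i<i′ _ _ = ⊥-elim (ui′≢ (after-i _ i<i′))
  ... | tri≈ _ i≡i′ _ = i≡i′
  ... | tri> _ _ i′<i = ⊥-elim (ui≢ (after-i′ _ i′<i))

  LinkedAt⇒LastDeviation : ∀ {i u v} → LinkedAt i u v → LastDeviation u i
  LinkedAt⇒LastDeviation (i<last , uv) =
    (λ ui≡ → SAdjAt-≢ G uv (trans ui≡ (SAdjAt-suffixˡ G uv i<last))) ,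
    (λ j i<j → trans (SAdjAt-suffixˡ G uv i<j) (sym (SAdjAt-suffixˡ G uv i<last)))

  LinkedAt-unique : ∀ {i u v w} → LinkedAt i u v → LinkedAt i u w → v ≗ w
  LinkedAt-unique {i} (i<last , uv) (_ , uw) j with <-cmp j i
  ... | tri< j<i _ _ = trans (sym (SAdjAt-prefix G uv j<i)) (SAdjAt-prefix G uw j<i)
  ... | tri≈ _ refl _ = trans (sym (SAdjAt-suffixˡ G uv i<last)) (SAdjAt-suffixˡ G uw i<last)
  ... | tri> _ _ i<j = trans (SAdjAt-suffixʳ G uv i<j) (sym (SAdjAt-suffixʳ G uw i<j))

  LinkingEdge⇒LinkedAt : ∀ {u v} (uv : LinkingEdge G u v) → LinkedAt (proj₁ uv) u v
  LinkingEdge⇒LinkedAt (_ , p , uv) = linking⇒<last p , uv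

  LinkingEdge-functional : ∀ {u v w} → LinkingEdge G u v → LinkingEdge G u w → v ≗ w
  LinkingEdge-functional uv@(i , _) uw@(i′ , _)
    with LastDeviation-unique (LinkedAt⇒LastDeviation (LinkingEdge⇒LinkedAt uv))
                              (LinkedAt⇒LastDeviation (LinkingEdge⇒LinkedAt uw))
  ... | refl = LinkedAt-unique (LinkingEdge⇒LinkedAt uv) (LinkingEdge⇒LinkedAt uw)

  EqOrLinked : W → W → Set
  EqOrLinked u v = u ≗ v ⊎ LinkingEdge G u v

  EqOrLinked-sym : ∀ {u v} → EqOrLinked u v → EqOrLinked v u
  EqOrLinked-sym (inj₁ u≗v) = inj₁ (λ j → sym (u≗v j))
  EqOrLinked-sym (inj₂ (i , p , uv)) = inj₂ (i , p , SAdjAt-sym G uv)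

  EqOrLinked-trans : ∀ {u v w} → EqOrLinked u v → EqOrLinked v w → EqOrLinked u w
  EqOrLinked-trans (inj₁ u≗v) (inj₁ v≗w) = inj₁ (λ j → trans (u≗v j) (v≗w j))
  EqOrLinked-trans (inj₁ u≗v) (inj₂ (i , p , vw)) = inj₂ (i , p , SAdjAt-respˡ G (λ j → sym (u≗v j)) vw)
  EqOrLinked-trans (inj₂ (i , p , uv)) (inj₁ v≗w) = inj₂ (i , p , SAdjAt-respʳ G v≗w uv)
  EqOrLinked-trans (inj₂ (i , p , uv)) (inj₂ vw) =
    inj₁ (LinkingEdge-functional (i , p , SAdjAt-sym G uv) vw)

  EqOrLinked-isEquivalence : IsEquivalence EqOrLinked
  EqOrLinked-isEquivalence = record
    { refl = inj₁ (λ _ → refl) ; sym = EqOrLinked-sym ; trans = EqOrLinked-trans }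

  Identified⇒EqOrLinked : ∀ {u v} → Identified G u v → EqOrLinked u v
  Identified⇒EqOrLinked = EC.fold EqOrLinked-isEquivalence inj₂

  representatives-EqOrLinked : ∀ {u v v′} → Identified G u v → Identified G u v′ → EqOrLinked v v′
  representatives-EqOrLinked u~v u~v′ =
    Identified⇒EqOrLinked (EC.transitive _ (EC.symmetric _ u~v) u~v′)

  GAdj⇒CopyEdge : ∀ {a b} → GAdj G a b →
                  Σ W λ a′ → Σ W λ b′ → Identified G a a′ × Identified G b b′ × CopyEdge a′ b′
  GAdj⇒CopyEdge (a≁b , a′ , b′ , a~a′ , b~b′ , i , a′b′) with i ≟ last
  ... | yes refl = a′ , b′ , a~a′ , b~b′ , a′b′
  ... | no i≢last = ⊥-elim (a≁b (EC.transitive _ a~a′ (EC.transitive _ a′~b′ (EC.symmetric _ b~b′))))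
    where a′~b′ = EC.return (i , <last⇒linking (Fin.≤∧≢⇒< (≤fromℕ i) i≢last) , a′b′)

  level : ∀ {u v} → EqOrLinked u v → ℕ
  level (inj₁ _) = suc t′
  level (inj₂ (i , _)) = toℕ i

  EqOrLinked-level≥t⇒≗ : ∀ {u v} (uv : EqOrLinked u v) → suc t′ ≤ level uv → u ≗ v
  EqOrLinked-level≥t⇒≗ (inj₁ u≗v) _ = u≗v
  EqOrLinked-level≥t⇒≗ (inj₂ (i , _)) t≤i = ⊥-elim (<⇒≱ (toℕ<n i) t≤i)

  EqOrLinked-split : ∀ {u v μ} (uv : EqOrLinked u v) → μ ≤ level uv → (μ<t : μ ℕ.< suc t′) →
                     let m = fromℕ< μ<t in
                     LinkedAt m u v ⊎ (μ ℕ.< level uv × u m ≡ v m)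
  EqOrLinked-split (inj₁ u≗v) _ μ<t = inj₂ (μ<t , u≗v _)
  EqOrLinked-split {μ = μ} (inj₂ (i , p , uv)) μ≤i μ<t with μ ℕ.≟ toℕ i
  ... | yes refl = inj₁ (subst (λ k → LinkedAt k _ _) (sym (fromℕ<-toℕ i μ<t)) (linking⇒<last p , uv))
  ... | no μ≢i = inj₂ (μ<i , SAdjAt-prefix G uv (subst (ℕ._< toℕ i) (sym (toℕ-fromℕ< μ<t)) μ<i))
    where μ<i = ≤∧≢⇒< μ≤i μ≢i

  module Hexagon (tf : TriangleFree G) {a₁ b₁ b₂ c₂ c₃ a₃ : W}
                 (e₁ : CopyEdge a₁ b₁) (e₂ : CopyEdge b₂ c₂) (e₃ : CopyEdge c₃ a₃) where
    open ≡-Reasoning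

    noLinks : a₃ ≗ a₁ → b₁ ≗ b₂ → c₂ ≗ c₃ → ⊥
    noLinks a₃≗a₁ b₁≗b₂ c₂≗c₃ = TriangleFree⇒¬3-cycle G tf
      (SAdjAt-adj G e₁)
      (subst₂ (Adj G) (sym (b₁≗b₂ last)) refl (SAdjAt-adj G e₂))
      (subst₂ (Adj G) (sym (c₂≗c₃ last)) (a₃≗a₁ last) (SAdjAt-adj G e₃))

    oneLink : ∀ {m} → LinkedAt m a₃ a₁ → b₁ m ≡ b₂ m → c₂ m ≡ c₃ m → ⊥
    oneLink {m} (m<last , a₃a₁) b₁m≡b₂m c₂m≡c₃m = SAdjAt-≢ G a₃a₁ (begin
      a₃ m ≡⟨ sym (SAdjAt-prefix G e₃ m<last) ⟩
      c₃ m ≡⟨ sym c₂m≡c₃m ⟩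
      c₂ m ≡⟨ sym (SAdjAt-prefix G e₂ m<last) ⟩
      b₂ m ≡⟨ sym b₁m≡b₂m ⟩
      b₁ m ≡⟨ sym (SAdjAt-prefix G e₁ m<last) ⟩
      a₁ m ∎)

    twoLinks : ∀ {m} → LinkedAt m b₁ b₂ → LinkedAt m c₂ c₃ → a₃ m ≡ a₁ m → ⊥
    twoLinks {m} (m<last , b₁b₂) (_ , c₂c₃) a₃m≡a₁m = SAdjAt-≢ G e₂ (begin
      b₂ last ≡⟨ SAdjAt-suffixʳ G b₁b₂ m<last ⟩
      b₁ m    ≡⟨ sym (SAdjAt-prefix G e₁ m<last) ⟩
      a₁ m    ≡⟨ sym a₃m≡a₁m ⟩
      a₃ m    ≡⟨ sym (SAdjAt-prefix G e₃ m<last) ⟩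
      c₃ m    ≡⟨ sym (SAdjAt-suffixˡ G c₂c₃ m<last) ⟩
      c₂ last ∎)

    threeLinks : ∀ {m} → LinkedAt m a₃ a₁ → LinkedAt m b₁ b₂ → LinkedAt m c₂ c₃ → ⊥
    threeLinks (m<last , a₃a₁) (_ , b₁b₂) (_ , c₂c₃) = TriangleFree⇒¬3-cycle G tf
      (subst₂ (Adj G) (sym (SAdjAt-prefix G e₁ m<last)) refl (SAdjAt-adj G b₁b₂))
      (subst₂ (Adj G) (sym (SAdjAt-prefix G e₂ m<last)) refl (SAdjAt-adj G c₂c₃))
      (subst₂ (Adj G) (sym (SAdjAt-prefix G e₃ m<last)) refl (SAdjAt-adj G a₃a₁))

  ¬hexagon-atLevel : TriangleFree G → ∀ {a₁ b₁ b₂ c₂ c₃ a₃} →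
                     CopyEdge a₁ b₁ → CopyEdge b₂ c₂ → CopyEdge c₃ a₃ →
                     (A : EqOrLinked a₃ a₁) (B : EqOrLinked b₁ b₂) (C : EqOrLinked c₂ c₃) →
                     (μ : ℕ) → μ ≤ level A → μ ≤ level B → μ ≤ level C →
                     ¬ (μ ℕ.< level A × μ ℕ.< level B × μ ℕ.< level C) → ⊥
  ¬hexagon-atLevel tf e₁ e₂ e₃ A B C μ μ≤A μ≤B μ≤C ¬below with μ <? suc t′
  ... | no μ≮t = Hexagon.noLinks tf e₁ e₂ e₃ (EqOrLinked-level≥t⇒≗ A (≤-trans (≮⇒≥ μ≮t) μ≤A))
                                              (EqOrLinked-level≥t⇒≗ B (≤-trans (≮⇒≥ μ≮t) μ≤B))
                                              (EqOrLinked-level≥t⇒≗ C (≤-trans (≮⇒≥ μ≮t) μ≤C))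
  ... | yes μ<t
    with EqOrLinked-split A μ≤A μ<t | EqOrLinked-split B μ≤B μ<t | EqOrLinked-split C μ≤C μ<t
  ... | inj₂ (μ<A , _) | inj₂ (μ<B , _) | inj₂ (μ<C , _) = ¬below (μ<A , μ<B , μ<C)
  ... | inj₁ a         | inj₂ (_ , b)   | inj₂ (_ , c)   = Hexagon.oneLink tf e₁ e₂ e₃ a b c
  ... | inj₂ (_ , a)   | inj₁ b         | inj₂ (_ , c)   = Hexagon.oneLink tf e₂ e₃ e₁ b c a
  ... | inj₂ (_ , a)   | inj₂ (_ , b)   | inj₁ c         = Hexagon.oneLink tf e₃ e₁ e₂ c a b
  ... | inj₂ (_ , a)   | inj₁ b         | inj₁ c         = Hexagon.twoLinks tf e₁ e₂ e₃ b c a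
  ... | inj₁ a         | inj₂ (_ , b)   | inj₁ c         = Hexagon.twoLinks tf e₂ e₃ e₁ c a b
  ... | inj₁ a         | inj₁ b         | inj₂ (_ , c)   = Hexagon.twoLinks tf e₃ e₁ e₂ a b c
  ... | inj₁ a         | inj₁ b         | inj₁ c         = Hexagon.threeLinks tf e₁ e₂ e₃ a b c

  ¬hexagon : TriangleFree G → ∀ {a₁ b₁ b₂ c₂ c₃ a₃} →
             CopyEdge a₁ b₁ → CopyEdge b₂ c₂ → CopyEdge c₃ a₃ →
             EqOrLinked a₃ a₁ → EqOrLinked b₁ b₂ → EqOrLinked c₂ c₃ → ⊥
  ¬hexagon tf e₁ e₂ e₃ A B C =
    ¬hexagon-atLevel tf e₁ e₂ e₃ A B C (level A ⊓ level B ⊓ level C)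
      (≤-trans (m⊓n≤m _ _) (m⊓n≤m _ _)) (≤-trans (m⊓n≤m _ _) (m⊓n≤n (level A) _)) (m⊓n≤n _ _)
      (λ (μ<A , μ<B , μ<C) → <-irrefl refl (⊓-glb (⊓-glb μ<A μ<B) μ<C))

  triangleFree : TriangleFree G → GasketTriangleFree G (suc t′)
  triangleFree tf (a , b , c , ab , bc , ac)
    with GAdj⇒CopyEdge ab | GAdj⇒CopyEdge bc | GAdj⇒CopyEdge ac
  ... | a₁ , b₁ , a~a₁ , b~b₁ , e₁ | b₂ , c₂ , b~b₂ , c~c₂ , e₂ | a₃ , c₃ , a~a₃ , c~c₃ , e₃ =
    ¬hexagon tf e₁ e₂ (SAdjAt-sym G e₃)
      (representatives-EqOrLinked a~a₃ a~a₁)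
      (representatives-EqOrLinked b~b₁ b~b₂)
      (representatives-EqOrLinked c~c₂ c~c₃)

mainTheorem12 : (n : ℕ) → 2 ≤ n → (G : SimpleGraph n) → (t : ℕ) → 1 ≤ t →
    TriangleFree G → GasketTriangleFree G t
mainTheorem12 n _ G zero ()
mainTheorem12 n _ G (suc t′) _ = Gasket.triangleFree G t′
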